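{- Let $n\ge2$. For every summation tree $T$ with $n$ leaves, the number of computationally inequivalent summations on $n$ distinct summands whose underlying tree is isomorphic to $T$ is at most $\frac{n!}{2}$, and this value is attained when $T$ is the ladder tree, i.e. it equals the number of ladder summations on $n$ summands.
   Context: A summation tree is a rooted full binary tree (every node has $0$ or $2$ children). Two summation trees are isomorphic if one can be obtained from the other by a finite sequence of swaps of the two children (with their subtrees) of internal nodes. A summation on $n$ distinct summands is a summation tree with $n$ leaves with a bijective labelling of its leaves by the summands; two summations are computationally equivalent if one can be obtained from the other by a finite sequence of such child swaps (carrying labels along). The ladder tree with $n\ge2$ leaves is the tree of $((\cdots((x_1+x_2)+x_3)+\cdots)+x_n)$. -}

module Defs where

open import Data.Nat using (ℕ; zero; suc; _+_)
open import Data.Fin using (Fin)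
open import Data.List using (List; []; _∷_; _++_; length; allFin)
open import Data.List.Relation.Unary.All using (All)
open import Data.List.Relation.Unary.Any using (Any)
open import Data.List.Relation.Unary.AllPairs using (AllPairs)
open import Data.List.Relation.Binary.Permutation.Propositional using (_↭_)
open import Data.Product using (_×_)
open import Relation.Nullary using (¬_)

data Tree : Set where
  leaf : Tree
  node : Tree → Tree → Tree

leafCount : Tree → ℕ
leafCount leaf       = 1
leafCount (node l r) = leafCount l + leafCount r

data _≅_ : Tree → Tree → Set where
  ≅-refl  : ∀ {t} → t ≅ t
  ≅-sym   : ∀ {s t} → s ≅ t → t ≅ s
  ≅-trans : ∀ {s t u} → s ≅ t → t ≅ u → s ≅ u
  ≅-swap  : ∀ {l r} → node l r ≅ node r l
  ≅-node  : ∀ {l l′ r r′} → l ≅ l′ → r ≅ r′ → node l r ≅ node l′ r′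

-- Ladder tree with n leaves (n ≥ 1): ((⋯((x₁+x₂)+x₃)+⋯)+xₙ).
-- (ladder 0 = leaf is junk; only used for n ≥ 2.)
ladder : ℕ → Tree
ladder zero             = leaf
ladder (suc zero)       = leaf
ladder (suc (suc k))    = node (ladder (suc k)) leaf

data LTree (n : ℕ) : Set where
  lleaf : Fin n → LTree n
  lnode : LTree n → LTree n → LTree n

shape : ∀ {n} → LTree n → Tree
shape (lleaf _)   = leaf
shape (lnode l r) = node (shape l) (shape r)

labels : ∀ {n} → LTree n → List (Fin n)
labels (lleaf i)   = i ∷ []
labels (lnode l r) = labels l ++ labels r

-- A summation on the n distinct summands Fin n: the leaf labelling is a
-- bijection onto Fin n (each summand occurs exactly once).
IsSummation : ∀ {n} → LTree n → Set
IsSummation {n} s = labels s ↭ allFin n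

data _≃_ {n : ℕ} : LTree n → LTree n → Set where
  ≃-refl  : ∀ {t} → t ≃ t
  ≃-sym   : ∀ {s t} → s ≃ t → t ≃ s
  ≃-trans : ∀ {s t u} → s ≃ t → t ≃ u → s ≃ u
  ≃-swap  : ∀ {l r} → lnode l r ≃ lnode r l
  ≃-node  : ∀ {l l′ r r′} → l ≃ l′ → r ≃ r′ → lnode l r ≃ lnode l′ r′

-- "The set {x | P x} has exactly k classes modulo _≈_":
-- there is a complete, irredundant list of k representatives.
NumClasses : {A : Set} → (A → Set) → (A → A → Set) → ℕ → Set
NumClasses {A} P _≈_ k =
  Data.Product.Σ (List A) λ L →
    (length L Relation.Binary.PropositionalEquality.≡ k)
    × All P L
    × AllPairs (λ a b → ¬ (a ≈ b)) L
    × (∀ x → P x → Any (x ≈_) L)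
  where import Relation.Binary.PropositionalEquality

SummationOfShape : (n : ℕ) → Tree → LTree n → Set
SummationOfShape n T s = IsSummation s × (shape s ≅ T)

-- Sorting the two children of every node by a total order on labelled trees gives a normal form
-- for computational equivalence, so for any shape the classes of summations are counted by
-- deduplicating the list of all labellings. Ladder summations are enumerated by choosing the
-- outermost summand and recursing, which gives n ⋯ 4 · 3 = n!/2 pairwise inequivalent ones.
-- For an arbitrary shape T, descend to a cherry (two sibling leaves) and list the remaining labels
-- in the order met: this yields a ladder, and equivalent ladders have the same unordered cherry and
-- the same remaining list, from which a summation of shape exactly T is recovered up to swapping
-- the cherry. Hence the classes of shape T inject into the n!/2 ladder classes.
module Submission where

open import Defs
open import Data.Empty using (⊥-elim)
open import Data.Fin using (Fin)
import Data.Fin as Fin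
open import Data.Fin.Properties using (pigeonhole)
open import Data.List
  using (List; []; _∷_; [_]; _++_; length; map; concatMap; filter; deduplicate; lookup; allFin; cartesianProductWith)
open import Data.List.Properties using (length-++; length-map; length-tabulate; ∷-injective)
open import Data.List.Membership.Propositional using (_∈_)
open import Data.List.Membership.Propositional.Properties
  using (∈-allFin; ∈-map⁺; ∈-map⁻; ∈-lookup; ∈-∃++; ∈-filter⁺; ∈-cartesianProductWith⁺; ∈-cartesianProductWith⁻)
open import Data.List.Relation.Binary.Permutation.Propositional using (_↭_; ↭-refl; ↭-sym; ↭-trans; prep; swap)
open import Data.List.Relation.Binary.Permutation.Propositional.Properties
  using (¬x∷xs↭[]; ↭-singleton-inv; ↭-length; ∈-resp-↭; All-resp-↭; drop-∷; shift; shifts; ++-comm; ++⁺; ++⁺ˡ)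
open import Data.List.Relation.Unary.All as All using (All; []; _∷_)
import Data.List.Relation.Unary.All.Properties as All
open import Data.List.Relation.Unary.AllPairs as AllPairs using (AllPairs; []; _∷_)
import Data.List.Relation.Unary.AllPairs.Properties as AllPairs
open import Data.List.Relation.Unary.Any as Any using (Any; here; there; any?)
import Data.List.Relation.Unary.Any.Properties as Any
open import Data.List.Relation.Unary.Unique.DecSetoid.Properties using (deduplicate-!)
open import Data.List.Relation.Unary.Unique.Propositional using (Unique)
open import Data.List.Relation.Unary.Unique.Propositional.Properties using (allFin⁺)
open import Data.Nat using (ℕ; zero; suc; _+_; _*_; _≤_; _<_; _/_; _!; s≤s)
open import Data.Nat.DivMod using (m*n/n≡m)
open import Data.Nat.Properties using (*-assoc; ≮⇒≥; suc-injective)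
open import Data.Product using (Σ; ∃; _×_; _,_; proj₁; proj₂; map₂)
import Data.Product as Product
open import Data.Sum using (_⊎_; inj₁; inj₂)
import Data.Sum as Sum
open import Function using (_∘_; _on_)
open import Relation.Binary.Bundles using (DecSetoid)
open import Relation.Binary.Definitions using (Decidable; DecidableEquality)
open import Relation.Binary.Structures using (IsEquivalence; IsDecEquivalence)
open import Relation.Binary.PropositionalEquality using (_≡_; _≢_; refl; sym; trans; cong; cong₂; subst)
open import Relation.Nullary using (¬_; Dec; yes; no)
import Relation.Nullary.Decidable as Dec

module _ {A : Set} where

  ↭-dec : DecidableEquality A → Decidable (_↭_ {A = A})
  ↭-dec _≟_ []       []       = yes ↭-refl
  ↭-dec _≟_ []       (_ ∷ _)  = no (¬x∷xs↭[] ∘ ↭-sym)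
  ↭-dec _≟_ (x ∷ xs) ys with any? (x ≟_) ys
  ... | no x∉ys = no λ p → x∉ys (∈-resp-↭ p (here refl))
  ... | yes x∈ys with h , t , refl ← ∈-∃++ x∈ys =
    Dec.map′ (λ p → ↭-trans (prep x p) (↭-sym (shift x h t)))
             (λ q → drop-∷ (↭-trans q (shift x h t)))
             (↭-dec _≟_ xs (h ++ t))

  ↭-pair-inv : ∀ {a b c d : A} → a ∷ b ∷ [] ↭ c ∷ d ∷ [] → (a ≡ c × b ≡ d) ⊎ (a ≡ d × b ≡ c)
  ↭-pair-inv p with ∈-resp-↭ p (here refl)
  ... | here refl = inj₁ (refl , ∷-injective (↭-singleton-inv (drop-∷ p)) .proj₁)
  ... | there (here refl) = inj₂ (refl , ∷-injective (↭-singleton-inv (drop-∷ (↭-trans p (swap _ _ ↭-refl)))) .proj₁)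

  ++-injective : ∀ (xs xs′ : List A) {ys ys′} → length xs ≡ length xs′ →
                 xs ++ ys ≡ xs′ ++ ys′ → xs ≡ xs′ × ys ≡ ys′
  ++-injective []       []         _    e = refl , e
  ++-injective (x ∷ xs) (x′ ∷ xs′) |xs| e with refl , e′ ← ∷-injective e =
    Product.map₁ (cong (x ∷_)) (++-injective xs xs′ (suc-injective |xs|) e′)

  length-concatMap : ∀ {B : Set} (f : A → List B) {c} xs →
                     All (λ x → length (f x) ≡ c) xs → length (concatMap f xs) ≡ length xs * c
  length-concatMap f []       []         = refl
  length-concatMap f (x ∷ xs) (fx ∷ fxs) = trans (length-++ (f x)) (cong₂ _+_ fx (length-concatMap f xs fxs))

  allPairs-lookup : ∀ {R : A → A → Set} {xs} → AllPairs R xs →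
                    ∀ {i j : Fin (length xs)} → i Fin.< j → R (lookup xs i) (lookup xs j)
  allPairs-lookup (Rx ∷ _)   {Fin.zero}  {Fin.suc j} _       = All.lookup Rx (∈-lookup j)
  allPairs-lookup (_  ∷ Rxs) {Fin.suc i} {Fin.suc j} (s≤s i<j) = allPairs-lookup Rxs i<j

  select : List A → List (A × List A)
  select []       = []
  select (x ∷ xs) = (x , xs) ∷ map (map₂ (x ∷_)) (select xs)

  length-select : ∀ xs → length (select xs) ≡ length xs
  length-select []       = refl
  length-select (x ∷ xs) = cong suc (trans (length-map _ (select xs)) (length-select xs))

  select-↭ : ∀ xs → All (λ (y , ys) → y ∷ ys ↭ xs) (select xs)
  select-↭ []       = []
  select-↭ (x ∷ xs) = ↭-refl ∷ All.map⁺ (All.map (λ e → ↭-trans (swap _ x ↭-refl) (prep x e)) (select-↭ xs))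

  select-∈ : ∀ {x} xs → x ∈ xs → Any (λ (y , ys) → y ≡ x × x ∷ ys ↭ xs) (select xs)
  select-∈ (y ∷ ys) (here refl) = here (refl , ↭-refl)
  select-∈ (y ∷ ys) (there x∈ys) =
    there (Any.map⁺ (Any.map (λ { (refl , e) → refl , ↭-trans (swap _ y ↭-refl) (prep y e) }) (select-∈ ys x∈ys)))

  select-All : ∀ {P : A → Set} {xs} → All P xs → All (λ (y , ys) → All P (y ∷ ys)) (select xs)
  select-All {xs = xs} Pxs = All.map (λ e → All-resp-↭ (↭-sym e) Pxs) (select-↭ xs)

  select-distinct : ∀ xs → Unique xs → AllPairs (_≢_ on proj₁) (select xs)
  select-distinct []       []         = []
  select-distinct (x ∷ xs) (x∉ ∷ xs!) =
    All.map⁺ (All.map All.head (select-All x∉)) ∷ AllPairs.map⁺ (select-distinct xs xs!)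

  select-Unique : ∀ xs → Unique xs → All (Unique ∘ proj₂) (select xs)
  select-Unique []       []         = []
  select-Unique (x ∷ xs) (x∉ ∷ xs!) =
    xs! ∷ All.map⁺ (All.zipWith (λ (x∉ys , ys!) → All.tail x∉ys ∷ ys!) (select-All x∉ , select-Unique xs xs!))

module _ {A : Set} {P : A → Set} {_≈_ : A → A → Set} where

  numClasses-deduplicate : IsDecEquivalence _≈_ → (xs : List A) → All P xs →
                           (∀ x → P x → Any (x ≈_) xs) → ∃ λ k → NumClasses P _≈_ k
  numClasses-deduplicate isDecEq xs Pxs cover =
    length ys , ys , refl , All.deduplicate⁺ _≟_ Pxs , deduplicate-! decSetoid xs ,
    λ x Px → Any.deduplicate⁺ _≟_ (λ z≈y x≈y → ≈-trans x≈y (≈-sym z≈y)) (cover x Px)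
    where
      open IsDecEquivalence isDecEq using (_≟_) renaming (sym to ≈-sym; trans to ≈-trans)
      decSetoid : DecSetoid _ _
      decSetoid = record { isDecEquivalence = isDecEq }
      ys : List A
      ys = deduplicate _≟_ xs

  numClasses-≤ : ∀ {B : Set} {Q : B → Set} {_≈′_ : B → B → Set} → IsEquivalence _≈′_ →
                 (f : ∀ x → P x → B) → (∀ x Px → Q (f x Px)) →
                 (∀ x y Px Py → f x Px ≈′ f y Py → x ≈ y) →
                 ∀ {k m} → NumClasses P _≈_ k → NumClasses Q _≈′_ m → k ≤ m
  numClasses-≤ {_≈′_ = _≈′_} isEq f f-Q f-injective
    (xs , refl , Pxs , xs-distinct , _) (ys , refl , _ , _ , ys-cover) = ≮⇒≥ noCollision
    where
      open IsEquivalence isEq using () renaming (sym to ≈′-sym; trans to ≈′-trans)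
      P-at : ∀ i → P (lookup xs i)
      P-at i = All.lookup Pxs (∈-lookup i)
      image : ∀ i → Any (f (lookup xs i) (P-at i) ≈′_) ys
      image i = ys-cover _ (f-Q _ (P-at i))
      noCollision : ¬ length ys < length xs
      noCollision ys<xs with i , j , i<j , same ← pigeonhole ys<xs (Any.index ∘ image) =
        allPairs-lookup xs-distinct i<j (f-injective _ _ (P-at i) (P-at j)
          (≈′-trans (Any.lookup-index (image i))
                    (≈′-sym (subst (λ z → f (lookup xs j) (P-at j) ≈′ lookup ys z) (sym same) (Any.lookup-index (image j))))))

data Comparison : Set where
  lt eq gt : Comparison

opposite : Comparison → Comparison
opposite lt = gt
opposite eq = eq
opposite gt = lt

_then_ : Comparison → Comparison → Comparison
lt then _ = lt
eq then c = c
gt then _ = gt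

opposite-then : ∀ c d → opposite c then opposite d ≡ opposite (c then d)
opposite-then lt _ = refl
opposite-then eq _ = refl
opposite-then gt _ = refl

then-eq : ∀ c d → c then d ≡ eq → c ≡ eq × d ≡ eq
then-eq eq _ e = refl , e

compareFin : ∀ {n} → Fin n → Fin n → Comparison
compareFin Fin.zero    Fin.zero    = eq
compareFin Fin.zero    (Fin.suc _) = lt
compareFin (Fin.suc _) Fin.zero    = gt
compareFin (Fin.suc i) (Fin.suc j) = compareFin i j

compareFin-opposite : ∀ {n} (i j : Fin n) → compareFin j i ≡ opposite (compareFin i j)
compareFin-opposite Fin.zero    Fin.zero    = refl
compareFin-opposite Fin.zero    (Fin.suc _) = refl
compareFin-opposite (Fin.suc _) Fin.zero    = refl
compareFin-opposite (Fin.suc i) (Fin.suc j) = compareFin-opposite i j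

compareFin-eq : ∀ {n} (i j : Fin n) → compareFin i j ≡ eq → i ≡ j
compareFin-eq Fin.zero    Fin.zero    _ = refl
compareFin-eq (Fin.suc i) (Fin.suc j) e = cong Fin.suc (compareFin-eq i j e)

node-injective : ∀ {A B C D} → node A B ≡ node C D → A ≡ C × B ≡ D
node-injective refl = refl , refl

≅-reflexive : ∀ {A B} → A ≡ B → A ≅ B
≅-reflexive refl = ≅-refl

ladderCount : ℕ → ℕ
ladderCount zero    = 1
ladderCount (suc k) = (3 + k) * ladderCount k

ladderCount-double : ∀ k → ladderCount k * 2 ≡ (2 + k) !
ladderCount-double zero    = refl
ladderCount-double (suc k) = trans (*-assoc (3 + k) (ladderCount k) 2) (cong ((3 + k) *_) (ladderCount-double k))

ShapeLift : ℕ → Tree → Tree → Set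
ShapeLift n A B = ∀ (s : LTree n) → shape s ≡ A → ∃ λ t → t ≃ s × shape t ≡ B

module _ {n : ℕ} where

  lleaf-injective : ∀ {x y : Fin n} → lleaf x ≡ lleaf y → x ≡ y
  lleaf-injective refl = refl

  lnode-injective : ∀ {a b c d : LTree n} → lnode a b ≡ lnode c d → a ≡ c × b ≡ d
  lnode-injective refl = refl , refl

  lnode≢lleaf : ∀ {a b : LTree n} {x} → lnode a b ≢ lleaf x
  lnode≢lleaf ()

  _≟_ : DecidableEquality (LTree n)
  lleaf x   ≟ lleaf y   = Dec.map′ (cong lleaf) lleaf-injective (x Fin.≟ y)
  lleaf _   ≟ lnode _ _ = no λ ()
  lnode _ _ ≟ lleaf _   = no λ ()
  lnode a b ≟ lnode c d = Dec.map′ (Product.uncurry (cong₂ lnode)) lnode-injective (a ≟ c Dec.×-dec b ≟ d)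

  compare : LTree n → LTree n → Comparison
  compare (lleaf x)   (lleaf y)   = compareFin x y
  compare (lleaf _)   (lnode _ _) = lt
  compare (lnode _ _) (lleaf _)   = gt
  compare (lnode a b) (lnode c d) = compare a c then compare b d

  compare-opposite : ∀ s t → compare t s ≡ opposite (compare s t)
  compare-opposite (lleaf x)   (lleaf y)   = compareFin-opposite x y
  compare-opposite (lleaf _)   (lnode _ _) = refl
  compare-opposite (lnode _ _) (lleaf _)   = refl
  compare-opposite (lnode a b) (lnode c d)
    rewrite compare-opposite a c | compare-opposite b d = opposite-then (compare a c) (compare b d)

  compare-eq : ∀ s t → compare s t ≡ eq → s ≡ t
  compare-eq (lleaf x)   (lleaf y)   e = cong lleaf (compareFin-eq x y e)
  compare-eq (lnode a b) (lnode c d) e with a≡c , b≡d ← then-eq (compare a c) (compare b d) e =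
    cong₂ lnode (compare-eq a c a≡c) (compare-eq b d b≡d)

  orient : Comparison → LTree n → LTree n → LTree n
  orient gt a b = lnode b a
  orient _  a b = lnode a b

  sortedNode : LTree n → LTree n → LTree n
  sortedNode a b = orient (compare a b) a b

  sortedNode-comm : ∀ a b → sortedNode a b ≡ sortedNode b a
  sortedNode-comm a b with compare a b | compare b a | compare-opposite a b | compare-eq a b
  ... | lt | .gt | refl | _   = refl
  ... | gt | .lt | refl | _   = refl
  ... | eq | .eq | refl | a≡b = cong₂ lnode (a≡b refl) (sym (a≡b refl))

  sortedNode-cases : ∀ a b → sortedNode a b ≡ lnode a b ⊎ sortedNode a b ≡ lnode b a
  sortedNode-cases a b with compare a b
  ... | lt = inj₁ refl
  ... | eq = inj₁ refl
  ... | gt = inj₂ refl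

  sortedNode-injective : ∀ {a b c d} → sortedNode a b ≡ sortedNode c d → (a ≡ c × b ≡ d) ⊎ (a ≡ d × b ≡ c)
  sortedNode-injective {a} {b} {c} {d} e with sortedNode-cases a b | sortedNode-cases c d
  ... | inj₁ e₁ | inj₁ e₂ = inj₁ (lnode-injective (trans (sym e₁) (trans e e₂)))
  ... | inj₁ e₁ | inj₂ e₂ = inj₂ (lnode-injective (trans (sym e₁) (trans e e₂)))
  ... | inj₂ e₁ | inj₁ e₂ = inj₂ (Product.swap (lnode-injective (trans (sym e₁) (trans e e₂))))
  ... | inj₂ e₁ | inj₂ e₂ = inj₁ (Product.swap (lnode-injective (trans (sym e₁) (trans e e₂))))

  canon : LTree n → LTree n
  canon (lleaf x)   = lleaf x
  canon (lnode l r) = sortedNode (canon l) (canon r)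

  sortedNode-≃ : ∀ a b → sortedNode a b ≃ lnode a b
  sortedNode-≃ a b with compare a b
  ... | lt = ≃-refl
  ... | eq = ≃-refl
  ... | gt = ≃-swap

  canon-≃ : ∀ s → canon s ≃ s
  canon-≃ (lleaf _)   = ≃-refl
  canon-≃ (lnode l r) = ≃-trans (sortedNode-≃ (canon l) (canon r)) (≃-node (canon-≃ l) (canon-≃ r))

  ≃⇒canon≡ : ∀ {s t} → s ≃ t → canon s ≡ canon t
  ≃⇒canon≡ ≃-refl          = refl
  ≃⇒canon≡ (≃-sym p)       = sym (≃⇒canon≡ p)
  ≃⇒canon≡ (≃-trans p q)   = trans (≃⇒canon≡ p) (≃⇒canon≡ q)
  ≃⇒canon≡ (≃-swap {l} {r}) = sortedNode-comm (canon l) (canon r)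
  ≃⇒canon≡ (≃-node p q)    = cong₂ sortedNode (≃⇒canon≡ p) (≃⇒canon≡ q)

  canon≡⇒≃ : ∀ {s t} → canon s ≡ canon t → s ≃ t
  canon≡⇒≃ {s} {t} e = ≃-trans (≃-sym (canon-≃ s)) (subst (_≃ t) (sym e) (canon-≃ t))

  ≃-isDecEquivalence : IsDecEquivalence (_≃_ {n})
  ≃-isDecEquivalence = record
    { isEquivalence = record { refl = ≃-refl ; sym = ≃-sym ; trans = ≃-trans }
    ; _≟_ = λ s t → Dec.map′ canon≡⇒≃ ≃⇒canon≡ (canon s ≟ canon t)
    }

  ≃-lnode-inv : ∀ {a b c d : LTree n} → lnode a b ≃ lnode c d → (a ≃ c × b ≃ d) ⊎ (a ≃ d × b ≃ c)
  ≃-lnode-inv p = Sum.map (Product.map canon≡⇒≃ canon≡⇒≃) (Product.map canon≡⇒≃ canon≡⇒≃)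
                          (sortedNode-injective (≃⇒canon≡ p))

  lleaf-≃-injective : ∀ {x y : Fin n} → lleaf x ≃ lleaf y → x ≡ y
  lleaf-≃-injective p = lleaf-injective (≃⇒canon≡ p)

  lnode≄lleaf : ∀ {a b : LTree n} {x} → ¬ lnode a b ≃ lleaf x
  lnode≄lleaf {a} {b} p with sortedNode-cases (canon a) (canon b)
  ... | inj₁ e = lnode≢lleaf (trans (sym e) (≃⇒canon≡ p))
  ... | inj₂ e = lnode≢lleaf (trans (sym e) (≃⇒canon≡ p))

  labels-↭ : ∀ {s t : LTree n} → s ≃ t → labels s ↭ labels t
  labels-↭ ≃-refl           = ↭-refl
  labels-↭ (≃-sym p)        = ↭-sym (labels-↭ p)
  labels-↭ (≃-trans p q)    = ↭-trans (labels-↭ p) (labels-↭ q)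
  labels-↭ (≃-swap {l} {r}) = ++-comm (labels l) (labels r)
  labels-↭ (≃-node p q)     = ++⁺ (labels-↭ p) (labels-↭ q)

  length-labels : ∀ (s : LTree n) → length (labels s) ≡ leafCount (shape s)
  length-labels (lleaf _)   = refl
  length-labels (lnode l r) = trans (length-++ (labels l)) (cong₂ _+_ (length-labels l) (length-labels r))

  length-labels-cong : ∀ (s t : LTree n) → shape s ≡ shape t → length (labels s) ≡ length (labels t)
  length-labels-cong s t e = trans (length-labels s) (trans (cong leafCount e) (sym (length-labels t)))

  labels-injective : ∀ (s t : LTree n) → shape s ≡ shape t → labels s ≡ labels t → s ≡ t
  labels-injective (lleaf _)   (lleaf _)     _ refl = refl
  labels-injective (lnode l r) (lnode l′ r′) e es
    with e-l , e-r ← node-injective e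
    with es-l , es-r ← ++-injective (labels l) (labels l′) (length-labels-cong l l′ e-l) es
    = cong₂ lnode (labels-injective l l′ e-l es-l) (labels-injective r r′ e-r es-r)


  shapeLift-trans : ∀ {A B C} → ShapeLift n A B → ShapeLift n B C → ShapeLift n A C
  shapeLift-trans f g s e with t , t≃s , t-shape ← f s e with u , u≃t , u-shape ← g t t-shape =
    u , ≃-trans u≃t t≃s , u-shape

  shapeLift-swap : ∀ {A B} → ShapeLift n (node A B) (node B A)
  shapeLift-swap (lnode a b) refl = lnode b a , ≃-swap , refl

  shapeLift-node : ∀ {A A′ B B′} → ShapeLift n A A′ → ShapeLift n B B′ → ShapeLift n (node A B) (node A′ B′)
  shapeLift-node f g (lnode a b) refl with a′ , a′≃a , a′-shape ← f a refl with b′ , b′≃b , b′-shape ← g b refl =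
    lnode a′ b′ , ≃-node a′≃a b′≃b , cong₂ node a′-shape b′-shape

  ≅⇒shapeLift : ∀ {A B} → A ≅ B → ShapeLift n A B × ShapeLift n B A
  ≅⇒shapeLift ≅-refl        = (λ s e → s , ≃-refl , e) , (λ s e → s , ≃-refl , e)
  ≅⇒shapeLift (≅-sym p)     = Product.swap (≅⇒shapeLift p)
  ≅⇒shapeLift (≅-trans p q) = shapeLift-trans (proj₁ (≅⇒shapeLift p)) (proj₁ (≅⇒shapeLift q))
                            , shapeLift-trans (proj₂ (≅⇒shapeLift q)) (proj₂ (≅⇒shapeLift p))
  ≅⇒shapeLift ≅-swap        = shapeLift-swap , shapeLift-swap
  ≅⇒shapeLift (≅-node p q)  = shapeLift-node (proj₁ (≅⇒shapeLift p)) (proj₁ (≅⇒shapeLift q))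
                            , shapeLift-node (proj₂ (≅⇒shapeLift p)) (proj₂ (≅⇒shapeLift q))

  reshape : ∀ {s T} → shape s ≅ T → ∃ λ t → t ≃ s × shape t ≡ T
  reshape {s} p = proj₁ (≅⇒shapeLift p) s refl

  labellings : Tree → List (LTree n)
  labellings leaf       = map lleaf (allFin n)
  labellings (node A B) = cartesianProductWith lnode (labellings A) (labellings B)

  labellings-complete : ∀ s → s ∈ labellings (shape s)
  labellings-complete (lleaf x)   = ∈-map⁺ lleaf (∈-allFin x)
  labellings-complete (lnode l r) = ∈-cartesianProductWith⁺ lnode (labellings-complete l) (labellings-complete r)

  labellings-sound : ∀ T {s} → s ∈ labellings T → shape s ≡ T
  labellings-sound leaf       s∈ with _ , _ , refl ← ∈-map⁻ lleaf s∈ = refl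
  labellings-sound (node A B) s∈ with a , b , a∈ , b∈ , refl ← ∈-cartesianProductWith⁻ lnode (labellings A) (labellings B) s∈ =
    cong₂ node (labellings-sound A a∈) (labellings-sound B b∈)

  infixl 30 _⊕_
  _⊕_ : LTree n → Fin n → LTree n
  t ⊕ x = lnode t (lleaf x)

  ⊕-cancelʳ : ∀ {t t′ x} → t ⊕ x ≃ t′ ⊕ x → t ≃ t′
  ⊕-cancelʳ p with ≃-lnode-inv p
  ... | inj₁ (t≃t′ , _)   = t≃t′
  ... | inj₂ (t≃x , x≃t′) = ≃-trans t≃x x≃t′

  ⊕-injectiveʳ : ∀ {t t′ x x′ A B} → shape t ≡ node A B → t ⊕ x ≃ t′ ⊕ x′ → x ≡ x′
  ⊕-injectiveʳ {t = lnode _ _} _ p with ≃-lnode-inv p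
  ... | inj₁ (_ , x≃x′) = lleaf-≃-injective x≃x′
  ... | inj₂ (t≃x′ , _) = ⊥-elim (lnode≄lleaf t≃x′)

  ladders : ℕ → List (Fin n) → List (LTree n)
  ladders zero    (a ∷ b ∷ []) = [ lnode (lleaf a) (lleaf b) ]
  ladders zero    _            = []
  ladders (suc k) S            = concatMap (λ (x , rest) → map (_⊕ x) (ladders k rest)) (select S)

  ladders-sound : ∀ k S → All (λ t → labels t ↭ S × shape t ≡ ladder (2 + k)) (ladders k S)
  ladders-sound zero    []               = []
  ladders-sound zero    (_ ∷ [])         = []
  ladders-sound zero    (_ ∷ _ ∷ [])     = (↭-refl , refl) ∷ []
  ladders-sound zero    (_ ∷ _ ∷ _ ∷ _)  = []
  ladders-sound (suc k) S = All.concat⁺ (All.map⁺ (All.map extend (select-↭ S)))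
    where
      extend : ∀ {x rest} → x ∷ rest ↭ S →
               All (λ t → labels t ↭ S × shape t ≡ ladder (3 + k)) (map (_⊕ x) (ladders k rest))
      extend {x} e = All.map⁺ (All.map (λ {t} (t↭ , t-shape) →
        ↭-trans (++-comm (labels t) [ x ]) (↭-trans (prep x t↭) e) , cong (λ A → node A leaf) t-shape) (ladders-sound k _))

  ladders-complete : ∀ k S s → labels s ↭ S → shape s ≡ ladder (2 + k) → Any (s ≃_) (ladders k S)
  ladders-complete zero (c ∷ d ∷ []) (lnode (lleaf a) (lleaf b)) p refl with ↭-pair-inv p
  ... | inj₁ (refl , refl) = here ≃-refl
  ... | inj₂ (refl , refl) = here ≃-swap
  ladders-complete zero [] (lnode (lleaf _) (lleaf _)) p refl with () ← ↭-length p
  ladders-complete zero (_ ∷ []) (lnode (lleaf _) (lleaf _)) p refl with () ← ↭-length p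
  ladders-complete zero (_ ∷ _ ∷ _ ∷ _) (lnode (lleaf _) (lleaf _)) p refl with () ← ↭-length p
  ladders-complete (suc k) S (lnode l (lleaf x)) p e =
    Any.concat⁺ (Any.map⁺ (Any.map extend (select-∈ S (∈-resp-↭ p (Any.++⁺ʳ (labels l) (here refl))))))
    where
      extend : ∀ {y rest} → y ≡ x × x ∷ rest ↭ S → Any (lnode l (lleaf x) ≃_) (map (_⊕ y) (ladders k rest))
      extend (refl , e′) = Any.map⁺ (Any.map (λ l≃t → ≃-node l≃t ≃-refl)
        (ladders-complete k _ l (drop-∷ (↭-trans (↭-trans (++-comm [ x ] (labels l)) p) (↭-sym e′)))
                                (proj₁ (node-injective e))))

  ladders-irredundant : ∀ k S → Unique S → AllPairs (λ s t → ¬ s ≃ t) (ladders k S)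
  ladders-irredundant zero    []              _  = []
  ladders-irredundant zero    (_ ∷ [])        _  = []
  ladders-irredundant zero    (_ ∷ _ ∷ [])    _  = [] ∷ []
  ladders-irredundant zero    (_ ∷ _ ∷ _ ∷ _) _  = []
  ladders-irredundant (suc k) S S! = AllPairs.concat⁺
    (All.map⁺ (All.map (λ rest! → AllPairs.map⁺ (AllPairs.map (λ t≄t′ → t≄t′ ∘ ⊕-cancelʳ) (ladders-irredundant k _ rest!)))
                       (select-Unique S S!)))
    (AllPairs.map⁺ (AllPairs.map (λ x≢x′ → All.map⁺ (All.map (λ (_ , t-shape) →
                                   All.map⁺ (All.universal (λ _ → x≢x′ ∘ ⊕-injectiveʳ t-shape) _))
                                 (ladders-sound k _)))
                                 (select-distinct S S!)))

  ladders-length : ∀ k S → length S ≡ 2 + k → length (ladders k S) ≡ ladderCount k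
  ladders-length zero    (_ ∷ _ ∷ []) _     = refl
  ladders-length (suc k) S            |S| =
    trans (length-concatMap _ (select S) (All.map block-length (select-↭ S)))
          (cong (_* ladderCount k) (trans (length-select S) |S|))
    where
      block-length : ∀ {x rest} → x ∷ rest ↭ S → length (map (_⊕ x) (ladders k rest)) ≡ ladderCount k
      block-length {x} {rest} e = trans (length-map (_⊕ x) (ladders k rest))
                                        (ladders-length k rest (suc-injective (trans (↭-length e) |S|)))

  -- (p , q , xs) encodes the ladder (((p + q) + xₘ) + ⋯) + x₁ for xs = x₁ ∷ ⋯ ∷ xₘ.
  LadderData : Set
  LadderData = Fin n × Fin n × List (Fin n)

  ladderOf : LadderData → LTree n
  ladderOf (p , q , [])     = lnode (lleaf p) (lleaf q)
  ladderOf (p , q , x ∷ xs) = ladderOf (p , q , xs) ⊕ x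

  summands : LadderData → List (Fin n)
  summands (p , q , xs) = p ∷ q ∷ xs

  _≈ᴸ_ : LadderData → LadderData → Set
  (p , q , xs) ≈ᴸ (p′ , q′ , xs′) = ((p ≡ p′ × q ≡ q′) ⊎ (p ≡ q′ × q ≡ p′)) × xs ≡ xs′

  labels-ladderOf : ∀ d → labels (ladderOf d) ↭ summands d
  labels-ladderOf (p , q , [])     = ↭-refl
  labels-ladderOf (p , q , x ∷ xs) =
    ↭-trans (++-comm (labels (ladderOf (p , q , xs))) [ x ])
            (↭-trans (prep x (labels-ladderOf (p , q , xs))) (shifts [ x ] (p ∷ q ∷ [])))

  shape-ladderOf : ∀ d → shape (ladderOf d) ≡ ladder (length (summands d))
  shape-ladderOf (p , q , [])     = refl
  shape-ladderOf (p , q , x ∷ xs) = cong (λ A → node A leaf) (shape-ladderOf (p , q , xs))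

  ladderOf≄lleaf : ∀ d {x} → ¬ ladderOf d ≃ lleaf x
  ladderOf≄lleaf (_ , _ , [])    = lnode≄lleaf
  ladderOf≄lleaf (_ , _ , _ ∷ _) = lnode≄lleaf

  ladderOf-≃-injective : ∀ {p q p′ q′} xs xs′ →
                         ladderOf (p , q , xs) ≃ ladderOf (p′ , q′ , xs′) → (p , q , xs) ≈ᴸ (p′ , q′ , xs′)
  ladderOf-≃-injective [] [] e with ≃-lnode-inv e
  ... | inj₁ (p≃p′ , q≃q′) = inj₁ (lleaf-≃-injective p≃p′ , lleaf-≃-injective q≃q′) , refl
  ... | inj₂ (p≃q′ , q≃p′) = inj₂ (lleaf-≃-injective p≃q′ , lleaf-≃-injective q≃p′) , refl
  ladderOf-≃-injective [] (_ ∷ xs′) e with ≃-lnode-inv e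
  ... | inj₁ (p≃ , _) = ⊥-elim (ladderOf≄lleaf (_ , _ , xs′) (≃-sym p≃))
  ... | inj₂ (_ , q≃) = ⊥-elim (ladderOf≄lleaf (_ , _ , xs′) (≃-sym q≃))
  ladderOf-≃-injective (_ ∷ xs) [] e with ≃-lnode-inv e
  ... | inj₁ (≃p′ , _) = ⊥-elim (ladderOf≄lleaf (_ , _ , xs) ≃p′)
  ... | inj₂ (≃q′ , _) = ⊥-elim (ladderOf≄lleaf (_ , _ , xs) ≃q′)
  ladderOf-≃-injective (_ ∷ xs) (_ ∷ xs′) e with ≃-lnode-inv e
  ... | inj₂ (≃x′ , _) = ⊥-elim (ladderOf≄lleaf (_ , _ , xs) ≃x′)
  ... | inj₁ (ladder≃ , x≃x′) with cherry , xs≡xs′ ← ladderOf-≃-injective xs xs′ ladder≃ =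
    cherry , cong₂ _∷_ (lleaf-≃-injective x≃x′) xs≡xs′

  addSummands : List (Fin n) → LadderData → LadderData
  addSummands ys (p , q , xs) = p , q , ys ++ xs

  peel : LTree n → LTree n → LadderData
  peel (lleaf a)     (lleaf b)     = a , b , []
  peel (lleaf a)     (lnode r₁ r₂) = addSummands [ a ] (peel r₁ r₂)
  peel (lnode l₁ l₂) r             = addSummands (labels r) (peel l₁ l₂)

  summands-peel : ∀ l r → summands (peel l r) ↭ labels l ++ labels r
  summands-peel (lleaf a)     (lleaf b)     = ↭-refl
  summands-peel (lleaf a)     (lnode r₁ r₂) = ↭-trans (shifts (_ ∷ _ ∷ []) [ a ]) (prep a (summands-peel r₁ r₂))
  summands-peel (lnode l₁ l₂) r             =
    ↭-trans (shifts (_ ∷ _ ∷ []) (labels r))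
            (↭-trans (++⁺ˡ (labels r) (summands-peel l₁ l₂)) (++-comm (labels r) (labels l₁ ++ labels l₂)))

  peel-injective : ∀ l r l′ r′ → shape l ≡ shape l′ → shape r ≡ shape r′ →
                   peel l r ≈ᴸ peel l′ r′ → lnode l r ≃ lnode l′ r′
  peel-injective (lleaf _) (lleaf _) (lleaf _) (lleaf _) _ _ (inj₁ (refl , refl) , _) = ≃-refl
  peel-injective (lleaf _) (lleaf _) (lleaf _) (lleaf _) _ _ (inj₂ (refl , refl) , _) = ≃-swap
  peel-injective (lleaf _) (lnode r₁ r₂) (lleaf _) (lnode r₁′ r₂′) _ e (cherry , xs≡xs′)
    with refl , rest ← ∷-injective xs≡xs′ =
    ≃-node ≃-refl (peel-injective r₁ r₂ r₁′ r₂′ (proj₁ (node-injective e)) (proj₂ (node-injective e)) (cherry , rest))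
  peel-injective (lnode l₁ l₂) r (lnode l₁′ l₂′) r′ e e′ (cherry , xs≡xs′)
    with r-labels , rest ← ++-injective (labels r) (labels r′) (length-labels-cong r r′ e′) xs≡xs′ =
    ≃-node (peel-injective l₁ l₂ l₁′ l₂′ (proj₁ (node-injective e)) (proj₂ (node-injective e)) (cherry , rest))
           (subst (r ≃_) (labels-injective r r′ e′ r-labels) ≃-refl)
  peel-injective (lleaf _)   (lleaf _)   (lleaf _)   (lnode _ _) _  () _
  peel-injective (lleaf _)   (lnode _ _) (lleaf _)   (lleaf _)   _  () _
  peel-injective (lleaf _)   _           (lnode _ _) _           () _  _
  peel-injective (lnode _ _) _           (lleaf _)   _           () _  _

  ladderise : LTree n → LTree n
  ladderise (lleaf x)   = lleaf x
  ladderise (lnode l r) = ladderOf (peel l r)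

  labels-ladderise : ∀ s → labels (ladderise s) ↭ labels s
  labels-ladderise (lleaf _)   = ↭-refl
  labels-ladderise (lnode l r) = ↭-trans (labels-ladderOf (peel l r)) (summands-peel l r)

  shape-ladderise : ∀ s → shape (ladderise s) ≡ ladder (leafCount (shape s))
  shape-ladderise (lleaf _)   = refl
  shape-ladderise (lnode l r) =
    trans (shape-ladderOf (peel l r))
          (cong ladder (trans (↭-length (summands-peel l r)) (length-labels (lnode l r))))

  ladderise-injective : ∀ s t → shape s ≡ shape t → ladderise s ≃ ladderise t → s ≃ t
  ladderise-injective (lleaf _)   (lleaf _)     _ e = e
  ladderise-injective (lnode l r) (lnode l′ r′) e e′ =
    peel-injective l r l′ r′ (proj₁ (node-injective e)) (proj₂ (node-injective e))
                   (ladderOf-≃-injective _ _ e′)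
  ladderise-injective (lleaf _)   (lnode _ _) () _
  ladderise-injective (lnode _ _) (lleaf _)   () _

  isSummation? : (s : LTree n) → Dec (IsSummation s)
  isSummation? s = ↭-dec Fin._≟_ (labels s) (allFin n)

  summationClasses : ∀ T → ∃ λ k → NumClasses (SummationOfShape n T) _≃_ k
  summationClasses T = numClasses-deduplicate ≃-isDecEquivalence candidates
    (All.zip (All.all-filter isSummation? (labellings T) ,
              All.filter⁺ isSummation? (All.tabulate (≅-reflexive ∘ labellings-sound T))))
    cover
    where
      candidates : List (LTree n)
      candidates = filter isSummation? (labellings T)
      cover : ∀ s → SummationOfShape n T s → Any (s ≃_) candidates
      cover s (s-sum , s≅T) with t , t≃s , t-shape ← reshape s≅T =
        Any.map (λ { refl → ≃-sym t≃s })
                (∈-filter⁺ isSummation? (subst (λ A → t ∈ labellings A) t-shape (labellings-complete t))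
                                        (↭-trans (labels-↭ t≃s) s-sum))

  -- ladderise separates classes only among trees of one and the same shape, hence the passage to shape exactly T.
  toLadder : ∀ {T} s → SummationOfShape n T s → LTree n
  toLadder s (_ , s≅T) = ladderise (proj₁ (reshape s≅T))

  toLadder-ladder : ∀ {T} → leafCount T ≡ n → ∀ s σ → SummationOfShape n (ladder n) (toLadder {T} s σ)
  toLadder-ladder |T| s (s-sum , s≅T) with t , t≃s , t-shape ← reshape s≅T =
    ↭-trans (labels-ladderise t) (↭-trans (labels-↭ t≃s) s-sum) ,
    ≅-reflexive (trans (shape-ladderise t) (cong ladder (trans (cong leafCount t-shape) |T|)))

  toLadder-injective : ∀ {T} s s′ σ σ′ → toLadder {T} s σ ≃ toLadder s′ σ′ → s ≃ s′
  toLadder-injective s s′ (_ , s≅T) (_ , s′≅T) e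
    with t , t≃s , t-shape ← reshape s≅T | t′ , t′≃s′ , t′-shape ← reshape s′≅T =
    ≃-trans (≃-sym t≃s) (≃-trans (ladderise-injective t t′ (trans t-shape (sym t′-shape)) e) t′≃s′)

ladderClasses : ∀ k → NumClasses (SummationOfShape (2 + k) (ladder (2 + k))) _≃_ (ladderCount k)
ladderClasses k =
  ladders k S , ladders-length k S (length-tabulate (λ i → i)) ,
  All.map (Product.map₂ ≅-reflexive) (ladders-sound k S) , ladders-irredundant k S (allFin⁺ _) , cover
  where
    S : List (Fin (2 + k))
    S = allFin (2 + k)
    cover : ∀ s → SummationOfShape (2 + k) (ladder (2 + k)) s → Any (s ≃_) (ladders k S)
    cover s (s-sum , s≅ladder) with t , t≃s , t-shape ← reshape s≅ladder =
      Any.map (≃-trans (≃-sym t≃s)) (ladders-complete k S t (↭-trans (labels-↭ t≃s) s-sum) t-shape)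

proposition17 : (n : ℕ) → 2 ≤ n →
    ((T : Tree) → leafCount T ≡ n →
      Σ ℕ (λ k → NumClasses (SummationOfShape n T) _≃_ k × k ≤ (n !) / 2))
    × NumClasses (SummationOfShape n (ladder n)) _≃_ ((n !) / 2)
proposition17 (suc zero)    (s≤s ())
proposition17 (suc (suc k)) _ = atMostHalf , subst (NumClasses _ _) (sym half) (ladderClasses k)
  where
    half : (2 + k) ! / 2 ≡ ladderCount k
    half = trans (cong (_/ 2) (sym (ladderCount-double k))) (m*n/n≡m (ladderCount k) 2)
    atMostHalf : ∀ T → leafCount T ≡ 2 + k →
                 Σ ℕ (λ m → NumClasses (SummationOfShape (2 + k) T) _≃_ m × m ≤ (2 + k) ! / 2)
    atMostHalf T |T| with m , classes ← summationClasses T =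
      m , classes ,
      subst (m ≤_) (sym half)
        (numClasses-≤ (IsDecEquivalence.isEquivalence ≃-isDecEquivalence)
                      toLadder (toLadder-ladder |T|) toLadder-injective classes (ladderClasses k))
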